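{- Let $p>2$ be prime and $e\ge 2$. Then $\mathrm{A\Gamma L}_1(p^e)$, acting on $\mathbb{F}_{p^e}$, is a $2$-transitive group whose derangement graph is disconnected.
   Context: $\mathrm{A\Gamma L}_1(q)$ is the group of permutations of $\mathbb{F}_q$ of the form $x\mapsto a x^{\sigma}+b$ with $a\in\mathbb{F}_q^\times$, $b\in\mathbb{F}_q$, $\sigma\in\mathrm{Gal}(\mathbb{F}_q/\mathbb{F}_p)$. The derangement graph of a permutation group $G$ is the Cayley graph on $G$ whose connection set is the set of fixed-point-free elements of $G$. -}

module Defs where

open import Level using (0ℓ)
open import Data.Nat using (ℕ; zero; suc)
open import Data.List using (List)
open import Data.List.Membership.Propositional using (_∈_)
open import Data.List.Relation.Unary.Unique.Propositional using (Unique)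
open import Data.Product using (Σ; ∃; _×_; _,_)
open import Relation.Binary.PropositionalEquality using (_≡_)
open import Relation.Nullary using (¬_)
open import Algebra.Structures using (IsCommutativeRing)
open import Function.Bundles using (Inverse)
open import Relation.Binary.PropositionalEquality using (setoid)

-- A finite field, with propositional equality as its equality.
-- Finiteness is witnessed by a duplicate-free list of all elements;
-- its order is the length of that list.
record FiniteField : Set₁ where
  infixl 6 _+_
  infixl 7 _*_
  field
    Carrier : Set
    _+_ _*_ : Carrier → Carrier → Carrier
    -_      : Carrier → Carrier
    0# 1#   : Carrier
    isCommutativeRing : IsCommutativeRing _≡_ _+_ _*_ -_ 0# 1#
    0≢1     : ¬ (0# ≡ 1#)
    inverse : ∀ x → ¬ (x ≡ 0#) → ∃ λ y → x * y ≡ 1#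
    elements : List Carrier
    elements-unique : Unique elements
    elements-complete : ∀ x → x ∈ elements

  natCast : ℕ → Carrier
  natCast zero = 0#
  natCast (suc n) = 1# + natCast n

module _ (F : FiniteField) where
  open FiniteField F

  -- Elements of Gal(F / F_p): field automorphisms of F fixing the
  -- prime field F_p = {n · 1} pointwise.
  record Gal : Set where
    field
      σ       : Carrier → Carrier
      σ-bij   : Inverse (setoid Carrier) (setoid Carrier)
      σ-bij-to : ∀ x → Inverse.to σ-bij x ≡ σ x
      σ-+     : ∀ x y → σ (x + y) ≡ σ x + σ y
      σ-*     : ∀ x y → σ (x * y) ≡ σ x * σ y
      σ-1     : σ 1# ≡ 1#
      σ-fixes-prime-field : ∀ n → σ (natCast n) ≡ natCast n

  IsAΓL : (Carrier → Carrier) → Set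
  IsAΓL f = Σ Carrier λ a → Σ Carrier λ b → Σ Gal λ g →
              ¬ (a ≡ 0#) × (∀ x → f x ≡ a * Gal.σ g x + b)

  AΓL₁ : Set
  AΓL₁ = Σ (Carrier → Carrier) IsAΓL

  act : AΓL₁ → Carrier → Carrier
  act (f , _) = f

  TwoTransitive : Set
  TwoTransitive = ∀ x₁ x₂ y₁ y₂ → ¬ (x₁ ≡ x₂) → ¬ (y₁ ≡ y₂) →
                  ∃ λ (g : AΓL₁) → act g x₁ ≡ y₁ × act g x₂ ≡ y₂

  IsDerangement : AΓL₁ → Set
  IsDerangement g = ∀ x → ¬ (act g x ≡ x)

  -- Edges of the derangement graph Cay(AΓL₁, D):
  -- g ~ h iff h g⁻¹ ∈ D, i.e. h = d ∘ g for some derangement d.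
  Adjacent : AΓL₁ → AΓL₁ → Set
  Adjacent g h = ∃ λ d → IsDerangement d × (∀ x → act h x ≡ act d (act g x))

  data Reachable : AΓL₁ → AΓL₁ → Set where
    same : ∀ {g h} → (∀ x → act g x ≡ act h x) → Reachable g h
    step : ∀ {g k h} → Adjacent g k → Reachable k h → Reachable g h

  DerangementGraphConnected : Set
  DerangementGraphConnected = ∀ g h → Reachable g h

module Submission where

-- The affine maps x ↦ a x + b alone are 2-transitive.  For the graph, let
-- χ(x) = x^((q-1)/2) be the quadratic character and call a = f(1) - f(0)
-- the slope of f = a σ(·) + b.  A derangement has χ(a) = 1, since otherwise
-- x ↦ x - a σ(x) is injective, hence onto, and f gets a fixed point.  As
-- χ commutes with σ, composing with a derangement preserves χ(slope) = 1,
-- so no walk from the identity reaches x ↦ c x for a non-square c; such c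
-- exist because X^((q-1)/2) - 1 has fewer than q - 1 roots.
--
-- Decidable equality of F, needed for counting, is
-- available since the disconnectedness claim is a negation.

open import Defs
open import Level using (Level; 0ℓ)
open import Data.Nat as ℕ using (ℕ; zero; suc; _<_; _≤_; z≤n; s≤s)
import Data.Nat.Properties as ℕP
open import Data.Nat.Primality using (Prime; composite)
open import Data.Nat.Divisibility using (divides)
open import Data.Nat.Tactic.RingSolver using (solve-∀)
open import Data.Integer as ℤ using (ℤ; -[1+_]; _⊖_)
import Data.Integer.Properties as ℤP
open import Data.Sign as Sign using (Sign)
open import Data.Maybe using (Maybe; just; nothing)
open import Data.List using (List; []; _∷_; length; map; foldr)
open import Data.List.Properties using (length-map; length-removeAt′)
open import Data.List.Membership.Propositional using (_∈_)
open import Data.List.Membership.Propositional.Properties using (∈-map⁻)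
open import Data.List.Relation.Unary.Any using (here; there; _─_; index)
open import Data.List.Relation.Unary.All as All using (All; []; _∷_)
open import Data.List.Relation.Unary.All.Properties using (─⁺; ¬Any⇒All¬)
open import Data.List.Relation.Unary.AllPairs using ([]; _∷_)
open import Data.List.Relation.Unary.Unique.Propositional using (Unique)
open import Data.List.Relation.Unary.Unique.Propositional.Properties using (map⁺)
open import Data.List.Relation.Binary.Subset.Propositional using (_⊆_)
open import Data.Product using (∃; _,_; proj₁; proj₂)
open import Data.Sum using (_⊎_; inj₁; inj₂)
open import Data.Empty using (⊥-elim)
open import Function using (_∘_)
open import Function.Construct.Identity using (↔-id)
open import Relation.Nullary using (¬_; Dec; yes; no)
open import Relation.Nullary.Decidable using (¬¬-excluded-middle)
open import Relation.Binary.Definitions using (DecidableEquality)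
open import Relation.Binary.PropositionalEquality
  using (_≡_; _≢_; refl; sym; trans; cong; cong₂; subst; subst₂; module ≡-Reasoning)
open import Algebra.Bundles using (CommutativeRing)
import Algebra.Solver.Ring.AlmostCommutativeRing as ACR

module Removal {A : Set} where

  ∈-─⁺ : ∀ {x z} {ys : List A} (x∈ys : x ∈ ys) → z ∈ ys → z ≢ x → z ∈ (ys ─ x∈ys)
  ∈-─⁺ (here refl) (here refl) z≢x = ⊥-elim (z≢x refl)
  ∈-─⁺ (here refl) (there z∈ys) _ = z∈ys
  ∈-─⁺ (there x∈ys) (here refl) _ = here refl
  ∈-─⁺ (there x∈ys) (there z∈ys) z≢x = there (∈-─⁺ x∈ys z∈ys z≢x)

  ─-unique : ∀ {x} {ys : List A} (x∈ys : x ∈ ys) → Unique ys → Unique (ys ─ x∈ys)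
  ─-unique (here refl) (_ ∷ u) = u
  ─-unique (there x∈ys) (y∉ys ∷ u) = ─⁺ x∈ys y∉ys ∷ ─-unique x∈ys u

  ∉-─ : ∀ {x z} {ys : List A} → Unique ys → (x∈ys : x ∈ ys) → z ∈ (ys ─ x∈ys) → z ≢ x
  ∉-─ (x∉ys ∷ _) (here refl) z∈ys z≡x = All.lookup x∉ys z∈ys (sym z≡x)
  ∉-─ (y∉ys ∷ _) (there x∈ys) (here refl) y≡x = All.lookup y∉ys x∈ys y≡x
  ∉-─ (_ ∷ u) (there x∈ys) (there z∈ys) = ∉-─ u x∈ys z∈ys

  ⊆-─ : ∀ {x} {xs ys : List A} → All (x ≢_) xs → (x∷xs⊆ys : x ∷ xs ⊆ ys) →
        xs ⊆ (ys ─ x∷xs⊆ys (here refl))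
  ⊆-─ x∉xs x∷xs⊆ys z∈xs =
    ∈-─⁺ (x∷xs⊆ys (here refl)) (x∷xs⊆ys (there z∈xs)) (λ z≡x → All.lookup x∉xs z∈xs (sym z≡x))

  unique-⊆⇒length≤ : ∀ {xs ys : List A} → Unique xs → xs ⊆ ys → length xs ≤ length ys
  unique-⊆⇒length≤ {[]} _ _ = z≤n
  unique-⊆⇒length≤ {x ∷ xs} {ys} (x∉xs ∷ u) x∷xs⊆ys = begin
    suc (length xs)           ≤⟨ s≤s (unique-⊆⇒length≤ u (⊆-─ x∉xs x∷xs⊆ys)) ⟩
    suc (length (ys ─ x∈ys))  ≡⟨ length-removeAt′ ys (index x∈ys) ⟨
    length ys                 ∎
    where
    open ℕP.≤-Reasoning
    x∈ys = x∷xs⊆ys (here refl)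

open Removal

module _ {A : Set} (_≟_ : DecidableEquality A) where
  open import Data.List.Membership.DecPropositional _≟_ using (_∈?_)

  injective⇒surjective : ∀ {E : List A} → Unique E → (∀ x → x ∈ E) →
    (f : A → A) → (∀ {x y} → f x ≡ f y → x ≡ y) → ∀ y → ∃ λ x → f x ≡ y
  injective⇒surjective {E} unique complete f injective y with y ∈? map f E
  ... | yes y∈fE with x , _ , y≡fx ← ∈-map⁻ f y∈fE = x , sym y≡fx
  ... | no y∉fE = ⊥-elim (ℕP.<-irrefl (length-map f E) too-long)
    where
    -- y ∷ map f E would be a duplicate-free list in E longer than E
    too-long : length (map f E) < length E
    too-long = unique-⊆⇒length≤ (¬Any⇒All¬ _ y∉fE ∷ map⁺ injective unique) (λ {z} _ → complete z)

¬¬-decidableEquality : ∀ {A : Set} (E : List A) → (∀ x → x ∈ E) → ¬ ¬ DecidableEquality A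
¬¬-decidableEquality {A} E complete =
  ¬¬-all (λ x → ∀ y → Dec (x ≡ y)) (λ x → ¬¬-all (λ y → Dec (x ≡ y)) (λ y → ¬¬-excluded-middle))
  where
  -- a property that cannot be refuted at any point cannot be refuted
  -- globally, as the points are those of the finite list E
  ¬¬-all : (P : A → Set) → (∀ x → ¬ ¬ P x) → ¬ ¬ (∀ x → P x)
  ¬¬-all P ¬¬P ¬∀P = on E (λ ∀P → ¬∀P (λ x → ∀P x (complete x)))
    where
    on : ∀ xs → ¬ ¬ (∀ x → x ∈ xs → P x)
    on [] ¬∀P = ¬∀P (λ _ ())
    on (x ∷ xs) ¬∀P = ¬¬P x λ Px → on xs λ ∀P →
      ¬∀P λ { y (here refl) → Px ; y (there y∈xs) → ∀P y y∈xs }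

module CommutativeFold {A : Set} (_∙_ : A → A → A) (ε : A)
  (assoc : ∀ x y z → (x ∙ y) ∙ z ≡ x ∙ (y ∙ z)) (comm : ∀ x y → x ∙ y ≡ y ∙ x) where

  fold : List A → A
  fold = foldr _∙_ ε

  fold-─ : ∀ {x} {ys : List A} (x∈ys : x ∈ ys) → fold ys ≡ x ∙ fold (ys ─ x∈ys)
  fold-─ (here refl) = refl
  fold-─ {x} {y ∷ ys} (there x∈ys) = begin
    y ∙ fold ys                    ≡⟨ cong (y ∙_) (fold-─ x∈ys) ⟩
    y ∙ (x ∙ fold (ys ─ x∈ys))     ≡⟨ assoc y x _ ⟨
    (y ∙ x) ∙ fold (ys ─ x∈ys)     ≡⟨ cong (_∙ fold (ys ─ x∈ys)) (comm y x) ⟩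
    (x ∙ y) ∙ fold (ys ─ x∈ys)     ≡⟨ assoc x y _ ⟩
    x ∙ (y ∙ fold (ys ─ x∈ys))     ∎
    where open ≡-Reasoning

  fold-⊆ : ∀ {xs ys : List A} → Unique xs → xs ⊆ ys → length ys ≤ length xs → fold xs ≡ fold ys
  fold-⊆ {[]} {[]} _ _ _ = refl
  fold-⊆ {x ∷ xs} {ys} (x∉xs ∷ u) x∷xs⊆ys ys≤ = begin
    x ∙ fold xs               ≡⟨ cong (x ∙_) (fold-⊆ u (⊆-─ x∉xs x∷xs⊆ys) shorter) ⟩
    x ∙ fold (ys ─ x∈ys)      ≡⟨ fold-─ x∈ys ⟨
    fold ys                   ∎
    where
    open ≡-Reasoning
    x∈ys = x∷xs⊆ys (here refl)
    shorter : length (ys ─ x∈ys) ≤ length xs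
    shorter = ℕ.s≤s⁻¹ (subst (_≤ suc (length xs)) (length-removeAt′ ys (index x∈ys)) ys≤)

  fold-map-injective : ∀ {xs : List A} {f : A → A} → Unique xs → (∀ {x y} → f x ≡ f y → x ≡ y) →
    (∀ {x} → x ∈ xs → f x ∈ xs) → fold (map f xs) ≡ fold xs
  fold-map-injective {xs} {f} u injective closed =
    fold-⊆ (map⁺ injective u) image⊆ (ℕP.≤-reflexive (sym (length-map f xs)))
    where
    image⊆ : map f xs ⊆ xs
    image⊆ z∈fxs with x , x∈xs , refl ← ∈-map⁻ f z∈fxs = closed x∈xs

-- The standard
-- library's solver works with integer coefficients, i.e. it needs the
-- canonical ring homomorphism ℤ → R, n ↦ n · 1, which is constructed here.
module IntegerSolver {c ℓ : Level} (R : CommutativeRing c ℓ) where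

  open CommutativeRing R
    using ( Carrier; _≈_; _+_; _*_; -_; _-_; 0#; 1#; setoid; +-monoid; semiring; ring
          ; +-cong; +-congˡ; +-congʳ; *-cong; -‿cong; +-assoc; +-comm; +-identityˡ; +-identityʳ; -‿inverseʳ )
    renaming (refl to ≈-refl; sym to ≈-sym; trans to ≈-trans)
  open import Algebra.Properties.Ring ring
    using (-0#≈0#; -‿involutive; -‿anti-homo-+; -‿distribˡ-*; -‿distribʳ-*)
  open import Algebra.Properties.Monoid.Mult +-monoid using (_×_; ×-homo-+)
  open import Algebra.Properties.Semiring.Mult semiring using (×1-homo-*)
  open import Relation.Binary.Reasoning.Setoid setoid

  ⟦_⟧ : ℤ → Carrier
  ⟦ ℤ.+ n ⟧ = n × 1#
  ⟦ -[1+ n ] ⟧ = - (suc n × 1#)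

  ⊖-homo : ∀ m n → ⟦ m ⊖ n ⟧ ≈ m × 1# - n × 1#
  ⊖-homo m zero = ≈-sym (≈-trans (+-congˡ -0#≈0#) (+-identityʳ _))
  ⊖-homo zero (suc n) = ≈-sym (+-identityˡ _)
  ⊖-homo (suc m) (suc n) = begin
    ⟦ suc m ⊖ suc n ⟧                     ≡⟨ cong ⟦_⟧ (ℤP.[1+m]⊖[1+n]≡m⊖n m n) ⟩
    ⟦ m ⊖ n ⟧                             ≈⟨ ⊖-homo m n ⟩
    m × 1# - n × 1#                       ≈⟨ cancel-1# (m × 1#) (n × 1#) ⟨
    suc m × 1# - suc n × 1#               ∎
    where
    cancel-1# : ∀ a b → (1# + a) - (1# + b) ≈ a - b
    cancel-1# a b = begin
      (1# + a) - (1# + b)                 ≈⟨ +-cong (+-comm 1# a) (-‿anti-homo-+ 1# b) ⟩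
      (a + 1#) + (- b - 1#)               ≈⟨ +-congˡ (+-comm (- b) (- 1#)) ⟩
      (a + 1#) + (- 1# - b)               ≈⟨ +-assoc a 1# _ ⟩
      a + (1# + (- 1# - b))               ≈⟨ +-congˡ (+-assoc 1# (- 1#) (- b)) ⟨
      a + ((1# - 1#) - b)                 ≈⟨ +-congˡ (+-congʳ (-‿inverseʳ 1#)) ⟩
      a + (0# - b)                        ≈⟨ +-congˡ (+-identityˡ _) ⟩
      a - b                               ∎

  +-homo : ∀ i j → ⟦ i ℤ.+ j ⟧ ≈ ⟦ i ⟧ + ⟦ j ⟧
  +-homo (ℤ.+ m) (ℤ.+ n) = ×-homo-+ 1# m n
  +-homo (ℤ.+ m) -[1+ n ] = ⊖-homo m (suc n)
  +-homo -[1+ m ] (ℤ.+ n) = ≈-trans (⊖-homo n (suc m)) (+-comm _ _)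
  +-homo -[1+ m ] -[1+ n ] = begin
    - (suc (suc (m ℕ.+ n)) × 1#)          ≡⟨ cong (λ k → - (suc k × 1#)) (ℕP.+-suc m n) ⟨
    - ((suc m ℕ.+ suc n) × 1#)            ≈⟨ -‿cong (×-homo-+ 1# (suc m) (suc n)) ⟩
    - (suc m × 1# + suc n × 1#)           ≈⟨ -‿anti-homo-+ _ _ ⟩
    - (suc n × 1#) - suc m × 1#           ≈⟨ +-comm _ _ ⟩
    - (suc m × 1#) - suc n × 1#           ∎

  -- integers multiply by signs and absolute values
  signed : Sign → Carrier → Carrier
  signed Sign.+ x = x
  signed Sign.- x = - x

  signed-◃ : ∀ s n → ⟦ s ℤ.◃ n ⟧ ≈ signed s (n × 1#)
  signed-◃ Sign.+ zero = ≈-refl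
  signed-◃ Sign.- zero = ≈-sym -0#≈0#
  signed-◃ Sign.+ (suc n) = ≈-refl
  signed-◃ Sign.- (suc n) = ≈-refl

  signed-abs : ∀ i → ⟦ i ⟧ ≈ signed (ℤ.sign i) (ℤ.∣ i ∣ × 1#)
  signed-abs (ℤ.+ n) = ≈-refl
  signed-abs -[1+ n ] = ≈-refl

  signed-* : ∀ s t x y → signed (s Sign.* t) (x * y) ≈ signed s x * signed t y
  signed-* Sign.+ Sign.+ x y = ≈-refl
  signed-* Sign.+ Sign.- x y = -‿distribʳ-* x y
  signed-* Sign.- Sign.+ x y = -‿distribˡ-* x y
  signed-* Sign.- Sign.- x y = begin
    x * y                                 ≈⟨ -‿involutive _ ⟨
    - - (x * y)                           ≈⟨ -‿cong (-‿distribˡ-* x y) ⟩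
    - (- x * y)                           ≈⟨ -‿distribʳ-* (- x) y ⟩
    - x * - y                             ∎

  *-homo : ∀ i j → ⟦ i ℤ.* j ⟧ ≈ ⟦ i ⟧ * ⟦ j ⟧
  *-homo i j = begin
    ⟦ (s Sign.* t) ℤ.◃ (∣i∣ ℕ.* ∣j∣) ⟧        ≈⟨ signed-◃ (s Sign.* t) (∣i∣ ℕ.* ∣j∣) ⟩
    signed (s Sign.* t) ((∣i∣ ℕ.* ∣j∣) × 1#) ≈⟨ signed-cong (s Sign.* t) (×1-homo-* ∣i∣ ∣j∣) ⟩
    signed (s Sign.* t) (∣i∣ × 1# * ∣j∣ × 1#) ≈⟨ signed-* s t _ _ ⟩
    signed s (∣i∣ × 1#) * signed t (∣j∣ × 1#) ≈⟨ *-cong (signed-abs i) (signed-abs j) ⟨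
    ⟦ i ⟧ * ⟦ j ⟧                            ∎
    where
    s = ℤ.sign i
    t = ℤ.sign j
    ∣i∣ = ℤ.∣ i ∣
    ∣j∣ = ℤ.∣ j ∣
    signed-cong : ∀ s {x y} → x ≈ y → signed s x ≈ signed s y
    signed-cong Sign.+ x≈y = x≈y
    signed-cong Sign.- x≈y = -‿cong x≈y

  -‿homo : ∀ i → ⟦ ℤ.- i ⟧ ≈ - ⟦ i ⟧
  -‿homo (ℤ.+ zero) = ≈-sym -0#≈0#
  -‿homo (ℤ.+ suc n) = ≈-refl
  -‿homo -[1+ n ] = ≈-sym (-‿involutive _)

  almostCommutativeRing : ACR.AlmostCommutativeRing c ℓ
  almostCommutativeRing = ACR.fromCommutativeRing R

  ℤ-homomorphism : ℤ.+-*-rawRing ACR.-Raw-AlmostCommutative⟶ almostCommutativeRing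
  ℤ-homomorphism = record
    { ⟦_⟧ = ⟦_⟧ ; +-homo = +-homo ; *-homo = *-homo ; -‿homo = -‿homo
    ; 0-homo = ≈-refl ; 1-homo = +-identityʳ 1# }

  coefficients≟ : ∀ i j → Maybe (⟦ i ⟧ ≈ ⟦ j ⟧)
  coefficients≟ i j with i ℤ.≟ j
  ... | yes refl = just ≈-refl
  ... | no _ = nothing

  open import Algebra.Solver.Ring ℤ.+-*-rawRing almostCommutativeRing ℤ-homomorphism coefficients≟
    public using (solve; _:=_; _:+_; _:*_; _:-_)

Odd : ℕ → Set
Odd n = ∃ λ h → n ≡ suc (h ℕ.+ h)

even-or-odd : ∀ n → (∃ λ h → n ≡ h ℕ.+ h) ⊎ Odd n
even-or-odd zero = inj₁ (0 , refl)
even-or-odd (suc n) with even-or-odd n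
... | inj₁ (h , n≡2h) = inj₂ (h , cong suc n≡2h)
... | inj₂ (h , n≡2h+1) = inj₁ (suc h , cong suc (trans n≡2h+1 (sym (ℕP.+-suc h h))))

odd-prime : ∀ {p} → Prime p → 2 < p → Odd p
odd-prime {p} p-prime 2<p with even-or-odd p
... | inj₂ p-odd = p-odd
... | inj₁ (h , p≡2h) = ⊥-elim (Prime.notComposite p-prime (composite 2<p (divides h p≡h*2)))
  where
  p≡h*2 : p ≡ h ℕ.* 2
  p≡h*2 = trans p≡2h (trans (cong (h ℕ.+_) (sym (ℕP.+-identityʳ h))) (ℕP.*-comm 2 h))

odd-* : ∀ {m n} → Odd m → Odd n → Odd (m ℕ.* n)
odd-* (a , refl) (b , refl) = (a ℕ.+ b ℕ.+ 2 ℕ.* a ℕ.* b) , product-form a b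
  where
  product-form : ∀ a b → suc (a ℕ.+ a) ℕ.* suc (b ℕ.+ b) ≡
                 suc ((a ℕ.+ b ℕ.+ 2 ℕ.* a ℕ.* b) ℕ.+ (a ℕ.+ b ℕ.+ 2 ℕ.* a ℕ.* b))
  product-form = solve-∀

odd-^ : ∀ {p} → Odd p → ∀ e → Odd (p ℕ.^ e)
odd-^ p-odd zero = 0 , refl
odd-^ p-odd (suc e) = odd-* p-odd (odd-^ p-odd e)

odd-prime-power : ∀ {p e} → Prime p → 2 < p → 1 ≤ e →
  ∃ λ k → p ℕ.^ e ≡ suc (suc k ℕ.+ suc k)
odd-prime-power {p} {suc e} p-prime 2<p _ with odd-^ (odd-prime p-prime 2<p) (suc e)
... | suc k , q≡ = k , q≡
... | zero , q≡1 = ⊥-elim (ℕP.<⇒≢ 1<p (sym (ℕP.m*n≡1⇒m≡1 p (p ℕ.^ e) q≡1)))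
  where
  1<p : 1 < p
  1<p = ℕP.<-trans (s≤s (s≤s z≤n)) 2<p

module FiniteFieldTheory (F : FiniteField) where

  open FiniteField F
    using (Carrier; isCommutativeRing; 0≢1; inverse; elements; elements-unique; elements-complete)

  commutativeRing : CommutativeRing 0ℓ 0ℓ
  commutativeRing = record { isCommutativeRing = isCommutativeRing }

  open CommutativeRing commutativeRing
    using ( _+_; _*_; -_; _-_; 0#; 1#; +-identityˡ; +-identityʳ; +-assoc; +-comm
          ; *-identityˡ; *-identityʳ; *-assoc; *-comm; zeroˡ; zeroʳ; distribʳ
          ; -‿inverseʳ; -‿inverseˡ; ring; +-group; +-monoid; commutativeSemiring )
  open import Algebra.Properties.Ring ring using (-0#≈0#; -‿involutive; -1*x≈-x; x+x≈x⇒x≈0)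
  open import Algebra.Properties.Group +-group
    using (inverseˡ-unique; inverseʳ-unique; x∙y⁻¹≈ε⇒x≈y; identityʳ-unique; ∙-cancelʳ)
  open import Algebra.Properties.Monoid.Mult +-monoid using (_×_; ×-homo-+)
  open import Algebra.Properties.CommutativeSemiring.Exp commutativeSemiring
    using (_^_; ^-homo-*; ^-distrib-*)
  open IntegerSolver commutativeRing using (solve; _:=_; _:+_; _:*_; _:-_)
  open ≡-Reasoning

  1≢0 : 1# ≢ 0#
  1≢0 = 0≢1 ∘ sym

  nonzero-*-zero : ∀ {x y} → x ≢ 0# → x * y ≡ 0# → y ≡ 0#
  nonzero-*-zero {x} {y} x≢0 xy≡0 with x⁻¹ , xx⁻¹≡1 ← inverse x x≢0 = begin
    y                ≡⟨ *-identityˡ y ⟨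
    1# * y           ≡⟨ cong (_* y) (trans (*-comm x⁻¹ x) xx⁻¹≡1) ⟨
    (x⁻¹ * x) * y    ≡⟨ *-assoc x⁻¹ x y ⟩
    x⁻¹ * (x * y)    ≡⟨ cong (x⁻¹ *_) xy≡0 ⟩
    x⁻¹ * 0#         ≡⟨ zeroʳ x⁻¹ ⟩
    0#               ∎

  *-nonzero : ∀ {x y} → x ≢ 0# → y ≢ 0# → x * y ≢ 0#
  *-nonzero x≢0 y≢0 = y≢0 ∘ nonzero-*-zero x≢0

  difference-zero : ∀ {x y} → x - y ≡ 0# → x ≡ y
  difference-zero = x∙y⁻¹≈ε⇒x≈y _ _

  *-cancelˡ-nonzero : ∀ {a x y} → a ≢ 0# → a * x ≡ a * y → x ≡ y
  *-cancelˡ-nonzero {a} {x} {y} a≢0 ax≡ay = difference-zero (nonzero-*-zero a≢0 (begin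
    a * (x - y)          ≡⟨ solve 3 (λ a x y → a :* (x :- y) := a :* x :- a :* y) refl a x y ⟩
    a * x - a * y        ≡⟨ cong (_- a * y) ax≡ay ⟩
    a * y - a * y        ≡⟨ -‿inverseʳ (a * y) ⟩
    0#                   ∎))

  ^-nonzero : ∀ {x} n → x ≢ 0# → x ^ n ≢ 0#
  ^-nonzero zero _ = 1≢0
  ^-nonzero (suc n) x≢0 = *-nonzero x≢0 (^-nonzero n x≢0)

  1^n≡1 : ∀ n → 1# ^ n ≡ 1#
  1^n≡1 zero = refl
  1^n≡1 (suc n) = trans (*-identityˡ _) (1^n≡1 n)

  module Automorphism (g : Gal F) where
    open Gal g using (σ; σ-+; σ-*; σ-1) public

    σ-0 : σ 0# ≡ 0#
    σ-0 = x+x≈x⇒x≈0 (σ 0#) (trans (sym (σ-+ 0# 0#)) (cong σ (+-identityˡ 0#)))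

    σ-neg : ∀ x → σ (- x) ≡ - σ x
    σ-neg x = inverseʳ-unique (σ x) (σ (- x))
      (trans (sym (σ-+ x (- x))) (trans (cong σ (-‿inverseʳ x)) σ-0))

    σ-- : ∀ x y → σ (x - y) ≡ σ x - σ y
    σ-- x y = trans (σ-+ x (- y)) (cong (σ x +_) (σ-neg y))

    σ-^ : ∀ x n → σ (x ^ n) ≡ σ x ^ n
    σ-^ x zero = σ-1
    σ-^ x (suc n) = trans (σ-* x (x ^ n)) (cong (σ x *_) (σ-^ x n))

    σ-±1 : ∀ {y} → y ≡ 1# ⊎ y ≡ - 1# → σ y ≡ y
    σ-±1 (inj₁ refl) = σ-1
    σ-±1 (inj₂ refl) = trans (σ-neg 1#) (cong -_ σ-1)

  open Automorphism using (σ)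

  semilinear-difference : ∀ {f : Carrier → Carrier} {a b} (g : Gal F) →
    (∀ x → f x ≡ a * σ g x + b) → ∀ x y → f x - f y ≡ a * σ g (x - y)
  semilinear-difference {f} {a} {b} g f≡ x y = begin
    f x - f y                            ≡⟨ cong₂ _-_ (f≡ x) (f≡ y) ⟩
    (a * σ g x + b) - (a * σ g y + b)    ≡⟨ solve 4 (λ a s t b → (a :* s :+ b) :- (a :* t :+ b)
                                                     := a :* (s :- t)) refl a (σ g x) (σ g y) b ⟩
    a * (σ g x - σ g y)                  ≡⟨ cong (a *_) (Automorphism.σ-- g x y) ⟨
    a * σ g (x - y)                      ∎

  slope : AΓL₁ F → Carrier
  slope h = act F h 1# - act F h 0#

  slope-semilinear : ∀ {f : Carrier → Carrier} {a b} (g : Gal F) →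
    (∀ x → f x ≡ a * σ g x + b) → f 1# - f 0# ≡ a
  slope-semilinear {f} {a} g f≡ = begin
    f 1# - f 0#       ≡⟨ semilinear-difference g f≡ 1# 0# ⟩
    a * σ g (1# - 0#) ≡⟨ cong (λ t → a * σ g t) (trans (cong (1# +_) -0#≈0#) (+-identityʳ 1#)) ⟩
    a * σ g 1#        ≡⟨ cong (a *_) (Gal.σ-1 g) ⟩
    a * 1#            ≡⟨ *-identityʳ a ⟩
    a                 ∎

  identityAutomorphism : Gal F
  identityAutomorphism = record
    { σ = λ x → x ; σ-bij = ↔-id Carrier ; σ-bij-to = λ _ → refl
    ; σ-+ = λ _ _ → refl ; σ-* = λ _ _ → refl ; σ-1 = refl ; σ-fixes-prime-field = λ _ → refl }

  affine : (a b : Carrier) → a ≢ 0# → AΓL₁ F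
  affine a b a≢0 = (λ x → a * x + b) , a , b , identityAutomorphism , a≢0 , (λ _ → refl)

  slope-affine : ∀ a b a≢0 → slope (affine a b a≢0) ≡ a
  slope-affine a b a≢0 = slope-semilinear identityAutomorphism (λ _ → refl)

  twoTransitive : TwoTransitive F
  twoTransitive x₁ x₂ y₁ y₂ x₁≢x₂ y₁≢y₂
    with d⁻¹ , dd⁻¹≡1 ← inverse (x₂ - x₁) (x₁≢x₂ ∘ sym ∘ difference-zero) =
    affine a b a≢0 , add-sub-cancel (a * x₁) y₁ , maps-x₂
    where
    a = (y₂ - y₁) * d⁻¹
    b = y₁ - a * x₁
    add-sub-cancel : ∀ u v → u + (v - u) ≡ v
    add-sub-cancel = solve 2 (λ u v → u :+ (v :- u) := v) refl
    a-scales : a * (x₂ - x₁) ≡ y₂ - y₁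
    a-scales = begin
      ((y₂ - y₁) * d⁻¹) * (x₂ - x₁)     ≡⟨ *-assoc _ d⁻¹ _ ⟩
      (y₂ - y₁) * (d⁻¹ * (x₂ - x₁))     ≡⟨ cong ((y₂ - y₁) *_) (trans (*-comm d⁻¹ _) dd⁻¹≡1) ⟩
      (y₂ - y₁) * 1#                    ≡⟨ *-identityʳ _ ⟩
      y₂ - y₁                           ∎
    a≢0 : a ≢ 0#
    a≢0 a≡0 = y₁≢y₂ (sym (difference-zero (begin
      y₂ - y₁                           ≡⟨ a-scales ⟨
      a * (x₂ - x₁)                     ≡⟨ cong (_* (x₂ - x₁)) a≡0 ⟩
      0# * (x₂ - x₁)                    ≡⟨ zeroˡ _ ⟩
      0#                                ∎)))
    maps-x₂ : a * x₂ + b ≡ y₂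
    maps-x₂ = begin
      a * x₂ + (y₁ - a * x₁)            ≡⟨ solve 4 (λ a x₂ x₁ y₁ → a :* x₂ :+ (y₁ :- a :* x₁)
                                                     := a :* (x₂ :- x₁) :+ y₁) refl a x₂ x₁ y₁ ⟩
      a * (x₂ - x₁) + y₁                ≡⟨ cong (_+ y₁) a-scales ⟩
      (y₂ - y₁) + y₁                    ≡⟨ solve 2 (λ y₂ y₁ → (y₂ :- y₁) :+ y₁ := y₂) refl y₂ y₁ ⟩
      y₂                                ∎

  -- Polynomials as coefficient lists, lowest degree first, evaluated by Horner's rule.
  eval : List Carrier → Carrier → Carrier
  eval [] x = 0#
  eval (c ∷ cs) x = c + x * eval cs x

  mutual
    eval-constant : ∀ {c cs} x → All (_≡ 0#) cs → eval (c ∷ cs) x ≡ c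
    eval-constant {c} {cs} x cs≡0 = begin
      c + x * eval cs x   ≡⟨ cong (λ t → c + x * t) (eval-zero x cs≡0) ⟩
      c + x * 0#          ≡⟨ cong (c +_) (zeroʳ x) ⟩
      c + 0#              ≡⟨ +-identityʳ c ⟩
      c                   ∎

    eval-zero : ∀ {cs} x → All (_≡ 0#) cs → eval cs x ≡ 0#
    eval-zero x [] = refl
    eval-zero x (c≡0 ∷ cs≡0) = trans (eval-constant x cs≡0) c≡0

  -- Synthetic division by X - r: the quotient of c + X·P(X) has as
  -- coefficients the values at r of the successive tails of P.
  quotient : Carrier → List Carrier → List Carrier
  quotient r [] = []
  quotient r (c ∷ cs) = eval (c ∷ cs) r ∷ quotient r cs

  length-quotient : ∀ r cs → length (quotient r cs) ≡ length cs
  length-quotient r [] = refl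
  length-quotient r (c ∷ cs) = cong suc (length-quotient r cs)

  division : ∀ r c cs x → eval (c ∷ cs) x ≡ (x - r) * eval (quotient r cs) x + eval (c ∷ cs) r
  division r c [] x = begin
    eval (c ∷ []) x                    ≡⟨ eval-constant x [] ⟩
    c                                  ≡⟨ eval-constant r [] ⟨
    eval (c ∷ []) r                    ≡⟨ +-identityˡ _ ⟨
    0# + eval (c ∷ []) r               ≡⟨ cong (_+ eval (c ∷ []) r) (zeroʳ (x - r)) ⟨
    (x - r) * 0# + eval (c ∷ []) r     ∎
  division r c (c′ ∷ cs) x = begin
    c + x * eval (c′ ∷ cs) x           ≡⟨ cong (λ t → c + x * t) (division r c′ cs x) ⟩
    c + x * ((x - r) * Q + R)          ≡⟨ solve 5 (λ c x r Q R → c :+ x :* ((x :- r) :* Q :+ R)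
                                                   := (x :- r) :* (R :+ x :* Q) :+ (c :+ r :* R))
                                                  refl c x r Q R ⟩
    (x - r) * (R + x * Q) + (c + r * R) ∎
    where
    Q = eval (quotient r cs) x
    R = eval (c′ ∷ cs) r

  quotient-zero : ∀ r cs → All (_≡ 0#) (quotient r cs) → All (_≡ 0#) cs
  quotient-zero r [] [] = []
  quotient-zero r (c ∷ cs) (value≡0 ∷ q≡0) = trans (sym (eval-constant r cs≡0)) value≡0 ∷ cs≡0
    where cs≡0 = quotient-zero r cs q≡0

  roots-bound : ∀ cs (rs : List Carrier) → Unique rs → length cs ≤ length rs →
    (∀ {x} → x ∈ rs → eval cs x ≡ 0#) → All (_≡ 0#) cs
  roots-bound [] rs _ _ _ = []
  roots-bound (c ∷ cs) (r ∷ rs) (r∉rs ∷ rs-unique) (s≤s cs≤rs) roots =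
    trans (sym (eval-constant r cs≡0)) (roots (here refl)) ∷ cs≡0
    where
    quotient-roots : ∀ {x} → x ∈ rs → eval (quotient r cs) x ≡ 0#
    quotient-roots {x} x∈rs = nonzero-*-zero x-r≢0 (begin
      (x - r) * Q                   ≡⟨ +-identityʳ _ ⟨
      (x - r) * Q + 0#              ≡⟨ cong ((x - r) * Q +_) (roots (here refl)) ⟨
      (x - r) * Q + eval (c ∷ cs) r ≡⟨ division r c cs x ⟨
      eval (c ∷ cs) x               ≡⟨ roots (there x∈rs) ⟩
      0#                            ∎)
      where
      Q = eval (quotient r cs) x
      x-r≢0 : x - r ≢ 0#
      x-r≢0 x-r≡0 = All.lookup r∉rs x∈rs (sym (difference-zero x-r≡0))
    cs≡0 : All (_≡ 0#) cs
    cs≡0 = quotient-zero r cs (roots-bound (quotient r cs) rs rs-unique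
             (subst (_≤ length rs) (sym (length-quotient r cs)) cs≤rs) quotient-roots)

  module OddOrder (_≟_ : DecidableEquality Carrier) (k : ℕ)
                  (order : length elements ≡ suc (suc k ℕ.+ suc k)) where

    nonzero : List Carrier
    nonzero = elements ─ elements-complete 0#

    length-nonzero : length nonzero ≡ suc k ℕ.+ suc k
    length-nonzero = ℕP.suc-injective
      (trans (sym (length-removeAt′ elements (index (elements-complete 0#)))) order)

    nonzero-unique : Unique nonzero
    nonzero-unique = ─-unique (elements-complete 0#) elements-unique

    nonzero-≢0 : ∀ {x} → x ∈ nonzero → x ≢ 0#
    nonzero-≢0 = ∉-─ elements-unique (elements-complete 0#)

    nonzero-complete : ∀ {x} → x ≢ 0# → x ∈ nonzero
    nonzero-complete {x} = ∈-─⁺ (elements-complete 0#) (elements-complete x)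

    module Product = CommutativeFold _*_ 1# *-assoc *-comm
    module Sum = CommutativeFold _+_ 0# +-assoc +-comm

    -- Fermat: a^(q-1) = 1 for a ≠ 0, since multiplication by a permutes
    -- the nonzero elements and so preserves their (nonzero) product.
    product-scaled : ∀ a xs → Product.fold (map (a *_) xs) ≡ a ^ length xs * Product.fold xs
    product-scaled a [] = sym (*-identityˡ 1#)
    product-scaled a (x ∷ xs) = begin
      (a * x) * Product.fold (map (a *_) xs)    ≡⟨ cong ((a * x) *_) (product-scaled a xs) ⟩
      (a * x) * (a ^ length xs * P)             ≡⟨ solve 4 (λ a x b P → (a :* x) :* (b :* P)
                                                          := (a :* b) :* (x :* P)) refl a x (a ^ length xs) P ⟩
      (a * a ^ length xs) * (x * P)             ∎
      where P = Product.fold xs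

    product-nonzero : ∀ xs → (∀ {x} → x ∈ xs → x ≢ 0#) → Product.fold xs ≢ 0#
    product-nonzero [] _ = 1≢0
    product-nonzero (x ∷ xs) xs≢0 = *-nonzero (xs≢0 (here refl)) (product-nonzero xs (xs≢0 ∘ there))

    fermat : ∀ {a} → a ≢ 0# → a ^ length nonzero ≡ 1#
    fermat {a} a≢0 = *-cancelˡ-nonzero (product-nonzero nonzero nonzero-≢0) (begin
      P * a ^ length nonzero                   ≡⟨ *-comm P _ ⟩
      a ^ length nonzero * P                   ≡⟨ product-scaled a nonzero ⟨
      Product.fold (map (a *_) nonzero)        ≡⟨ Product.fold-map-injective nonzero-unique
                                                    (*-cancelˡ-nonzero a≢0) a*-preserves-nonzero ⟩
      P                                        ≡⟨ *-identityʳ P ⟨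
      P * 1#                                   ∎)
      where
      P = Product.fold nonzero
      a*-preserves-nonzero : ∀ {x} → x ∈ nonzero → a * x ∈ nonzero
      a*-preserves-nonzero x∈ = nonzero-complete (*-nonzero a≢0 (nonzero-≢0 x∈))

    -- The characteristic: q · 1 = 0, since x ↦ x + 1 permutes F and so
    -- preserves the sum of all elements.
    sum-shifted : ∀ xs → Sum.fold (map (_+ 1#) xs) ≡ Sum.fold xs + length xs × 1#
    sum-shifted [] = sym (+-identityʳ 0#)
    sum-shifted (x ∷ xs) = begin
      (x + 1#) + Sum.fold (map (_+ 1#) xs)      ≡⟨ cong ((x + 1#) +_) (sum-shifted xs) ⟩
      (x + 1#) + (S + length xs × 1#)           ≡⟨ solve 4 (λ x o S n → (x :+ o) :+ (S :+ n)
                                                          := (x :+ S) :+ (o :+ n)) refl x 1# S (length xs × 1#) ⟩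
      (x + S) + (1# + length xs × 1#)           ∎
      where S = Sum.fold xs

    characteristic : length elements × 1# ≡ 0#
    characteristic = identityʳ-unique (Sum.fold elements) _ (begin
      Sum.fold elements + length elements × 1#  ≡⟨ sum-shifted elements ⟨
      Sum.fold (map (_+ 1#) elements)           ≡⟨ Sum.fold-map-injective elements-unique (∙-cancelʳ 1# _ _)
                                                     (λ {x} _ → elements-complete (x + 1#)) ⟩
      Sum.fold elements                         ∎)

    -- As q is odd, the characteristic is not 2.
    2≢0 : 1# + 1# ≢ 0#
    2≢0 2≡0 = 1≢0 (begin
      1#                                        ≡⟨ +-identityʳ 1# ⟨
      1# + 0#                                   ≡⟨ cong (1# +_) (double-zero (suc k)) ⟨
      1# + (suc k ℕ.+ suc k) × 1#               ≡⟨ cong (_× 1#) order ⟨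
      length elements × 1#                      ≡⟨ characteristic ⟩
      0#                                        ∎)
      where
      double-zero : ∀ n → (n ℕ.+ n) × 1# ≡ 0#
      double-zero n = begin
        (n ℕ.+ n) × 1#             ≡⟨ ×-homo-+ 1# n n ⟩
        n × 1# + n × 1#            ≡⟨ cong₂ _+_ (*-identityˡ _) (*-identityˡ _) ⟨
        1# * n × 1# + 1# * n × 1#  ≡⟨ distribʳ (n × 1#) 1# 1# ⟨
        (1# + 1#) * n × 1#         ≡⟨ cong (_* n × 1#) 2≡0 ⟩
        0# * n × 1#                ≡⟨ zeroˡ _ ⟩
        0#                         ∎

    self-negative⇒zero : ∀ {c} → c ≡ - c → c ≡ 0#
    self-negative⇒zero {c} c≡-c = nonzero-*-zero 2≢0 (begin
      (1# + 1#) * c          ≡⟨ distribʳ c 1# 1# ⟩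
      1# * c + 1# * c        ≡⟨ cong₂ _+_ (*-identityˡ c) (*-identityˡ c) ⟩
      c + c                  ≡⟨ cong (c +_) c≡-c ⟩
      c - c                  ≡⟨ -‿inverseʳ c ⟩
      0#                     ∎)

    -- The quadratic character χ(x) = x^((q-1)/2); it takes the values ±1 on
    -- nonzero elements and is fixed by every Galois automorphism.
    χ : Carrier → Carrier
    χ x = x ^ suc k

    χ-square : ∀ {x} → x ≢ 0# → χ x * χ x ≡ 1#
    χ-square {x} x≢0 = begin
      χ x * χ x                 ≡⟨ ^-homo-* x (suc k) (suc k) ⟨
      x ^ (suc k ℕ.+ suc k)     ≡⟨ cong (x ^_) length-nonzero ⟨
      x ^ length nonzero        ≡⟨ fermat x≢0 ⟩
      1#                        ∎

    square-root-of-1 : ∀ {y} → y * y ≡ 1# → y ≡ 1# ⊎ y ≡ - 1#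
    square-root-of-1 {y} y²≡1 with y ≟ 1#
    ... | yes y≡1 = inj₁ y≡1
    ... | no y≢1 = inj₂ (inverseˡ-unique y 1# (nonzero-*-zero (y≢1 ∘ difference-zero) (begin
      (y - 1#) * (y + 1#)       ≡⟨ solve 2 (λ y o → (y :- o) :* (y :+ o) := y :* y :- o :* o) refl y 1# ⟩
      y * y - 1# * 1#           ≡⟨ cong₂ _-_ y²≡1 (*-identityˡ 1#) ⟩
      1# - 1#                   ≡⟨ -‿inverseʳ 1# ⟩
      0#                        ∎)))

    χ-±1 : ∀ {x} → x ≢ 0# → χ x ≡ 1# ⊎ χ x ≡ - 1#
    χ-±1 = square-root-of-1 ∘ χ-square

    χ-σ : ∀ (g : Gal F) {x} → x ≢ 0# → χ (σ g x) ≡ χ x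
    χ-σ g {x} x≢0 = trans (sym (Automorphism.σ-^ g x (suc k))) (Automorphism.σ-±1 g (χ-±1 x≢0))

    -- Key lemma: a derangement x ↦ a σ(x) + b has χ(a) = 1.  If χ(a) = -1,
    -- then z = a σ(z) forces χ(z) = -χ(z), so z = 0; hence x ↦ x - a σ(x)
    -- is injective, thus surjective, and a preimage of b is a fixed point.
    derangement⇒χ≡1 : ∀ {a b} (g : Gal F) → a ≢ 0# → (∀ x → a * σ g x + b ≢ x) → χ a ≡ 1#
    derangement⇒χ≡1 {a} {b} g a≢0 fixed-point-free with χ-±1 a≢0
    ... | inj₁ χa≡1 = χa≡1
    ... | inj₂ χa≡-1 = ⊥-elim (fixed-point-free x (begin
      a * σ g x + b             ≡⟨ cong (a * σ g x +_) Lx≡b ⟨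
      a * σ g x + L x           ≡⟨ solve 2 (λ u v → u :+ (v :- u) := v) refl (a * σ g x) x ⟩
      x                         ∎))
      where
      only-zero-fixed : ∀ z → z ≡ a * σ g z → z ≡ 0#
      only-zero-fixed z z≡aσz with z ≟ 0#
      ... | yes z≡0 = z≡0
      ... | no z≢0 = ⊥-elim (^-nonzero (suc k) z≢0 (self-negative⇒zero (begin
        χ z                     ≡⟨ cong χ z≡aσz ⟩
        χ (a * σ g z)           ≡⟨ ^-distrib-* a (σ g z) (suc k) ⟩
        χ a * χ (σ g z)         ≡⟨ cong₂ _*_ χa≡-1 (χ-σ g z≢0) ⟩
        - 1# * χ z              ≡⟨ -1*x≈-x (χ z) ⟩
        - χ z                   ∎)))

      L : Carrier → Carrier
      L x = x - a * σ g x

      L-injective : ∀ {x y} → L x ≡ L y → x ≡ y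
      L-injective {x} {y} Lx≡Ly = difference-zero (only-zero-fixed (x - y) (difference-zero (begin
        (x - y) - a * σ g (x - y)       ≡⟨ cong (λ t → (x - y) - a * t) (Automorphism.σ-- g x y) ⟩
        (x - y) - a * (σ g x - σ g y)   ≡⟨ solve 5 (λ x y a s t → (x :- y) :- a :* (s :- t)
                                                     := (x :- a :* s) :- (y :- a :* t))
                                                    refl x y a (σ g x) (σ g y) ⟩
        L x - L y                       ≡⟨ cong (_- L y) Lx≡Ly ⟩
        L y - L y                       ≡⟨ -‿inverseʳ (L y) ⟩
        0#                              ∎)))

      preimage = injective⇒surjective _≟_ elements-unique elements-complete L L-injective b
      x = proj₁ preimage
      Lx≡b = proj₂ preimage

    SquareSlope : AΓL₁ F → Set
    SquareSlope h = χ (slope h) ≡ 1#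

    adjacent-preserves : ∀ {g h} → Adjacent F g h → SquareSlope g → SquareSlope h
    adjacent-preserves {g} {h} ((d , a , b , τ , a≢0 , d≡) , derangement , h≡dg) χ-slope-g = begin
      χ (slope h)                   ≡⟨ cong χ slope-h ⟩
      χ (a * σ τ (slope g))         ≡⟨ ^-distrib-* a _ (suc k) ⟩
      χ a * χ (σ τ (slope g))       ≡⟨ cong₂ _*_ χa≡1 (sym (Automorphism.σ-^ τ (slope g) (suc k))) ⟩
      1# * σ τ (χ (slope g))        ≡⟨ cong (λ t → 1# * σ τ t) χ-slope-g ⟩
      1# * σ τ 1#                   ≡⟨ *-identityˡ _ ⟩
      σ τ 1#                        ≡⟨ Gal.σ-1 τ ⟩
      1#                            ∎
      where
      slope-h : slope h ≡ a * σ τ (slope g)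
      slope-h = trans (cong₂ _-_ (h≡dg 1#) (h≡dg 0#)) (semilinear-difference τ d≡ _ _)
      χa≡1 : χ a ≡ 1#
      χa≡1 = derangement⇒χ≡1 τ a≢0 (λ x fixed → derangement x (trans (d≡ x) fixed))

    reachable-preserves : ∀ {g h} → Reachable F g h → SquareSlope g → SquareSlope h
    reachable-preserves (same g≗h) = subst (λ s → χ s ≡ 1#) (cong₂ _-_ (g≗h 1#) (g≗h 0#))
    reachable-preserves {g} (step {k = g′} g~g′ g′⇝h) =
      reachable-preserves g′⇝h ∘ adjacent-preserves {g} {g′} g~g′

    monomial : ℕ → List Carrier
    monomial zero = 1# ∷ []
    monomial (suc n) = 0# ∷ monomial n

    eval-monomial : ∀ n x → eval (monomial n) x ≡ x ^ n
    eval-monomial zero x = eval-constant x []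
    eval-monomial (suc n) x = trans (+-identityˡ _) (cong (x *_) (eval-monomial n x))

    length-monomial : ∀ n → length (monomial n) ≡ suc n
    length-monomial zero = refl
    length-monomial (suc n) = cong suc (length-monomial n)

    -- χ is not constantly 1 on the nonzero elements: the polynomial
    -- X^((q-1)/2) - 1 has fewer coefficients than the q - 1 would-be roots.
    nonsquare-exists : ¬ (∀ {x} → x ≢ 0# → χ x ≡ 1#)
    nonsquare-exists χ≡1 = 1≢0 (begin
      1#          ≡⟨ -‿involutive 1# ⟨
      - - 1#      ≡⟨ cong -_ (All.head (roots-bound (- 1# ∷ monomial k) nonzero nonzero-unique
                                          few-coefficients roots)) ⟩
      - 0#        ≡⟨ -0#≈0# ⟩
      0#          ∎)
      where
      few-coefficients : length (- 1# ∷ monomial k) ≤ length nonzero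
      few-coefficients = subst₂ _≤_ (cong suc (sym (length-monomial k))) (sym length-nonzero)
                           (s≤s (ℕP.m≤n+m (suc k) k))
      roots : ∀ {x} → x ∈ nonzero → eval (- 1# ∷ monomial k) x ≡ 0#
      roots {x} x∈ = begin
        - 1# + x * eval (monomial k) x   ≡⟨ cong (λ t → - 1# + x * t) (eval-monomial k x) ⟩
        - 1# + χ x                       ≡⟨ cong (- 1# +_) (χ≡1 (nonzero-≢0 x∈)) ⟩
        - 1# + 1#                        ≡⟨ -‿inverseˡ 1# ⟩
        0#                               ∎

    -- The derangement graph is disconnected: a walk from the identity to
    -- x ↦ c x would make every c ≠ 0 a square.
    disconnected : ¬ DerangementGraphConnected F
    disconnected connected = nonsquare-exists λ {c} c≢0 →
      subst (λ s → χ s ≡ 1#) (slope-affine c 0# c≢0)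
        (reachable-preserves (connected identity (affine c 0# c≢0)) identity-square)
      where
      identity = affine 1# 0# 1≢0
      identity-square : SquareSlope identity
      identity-square = trans (cong χ (slope-affine 1# 0# 1≢0)) (1^n≡1 (suc k))

open import Data.Nat using (_^_)
open import Data.Product using (_×_)

proposition5p8 : (p e : ℕ) → Prime p → 2 < p → 2 ≤ e →
    (F : FiniteField) → length (FiniteField.elements F) ≡ p ^ e →
    TwoTransitive F × ¬ DerangementGraphConnected F
proposition5p8 p e p-prime 2<p 2≤e F |F|≡pᵉ
  with k , pᵉ≡2[k+1]+1 ← odd-prime-power p-prime 2<p (ℕP.<⇒≤ 2≤e) =
  twoTransitive , λ connected →
    ¬¬-decidableEquality elements elements-complete λ _≟_ →
      OddOrder.disconnected _≟_ k (trans |F|≡pᵉ pᵉ≡2[k+1]+1) connected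
  where
  open FiniteField F using (elements; elements-complete)
  open FiniteFieldTheory F using (twoTransitive; module OddOrder)
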